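{- Let $n$, $m$, $h$ be integers with $n\geq m\geq h\geq 2$ and $n>\frac{m-1}{1-2^{\frac{1}{1-h}}}+h-1$. Then for every integer $i$ with $1\le i\le h$, $$(h-i)\left(\sum_{l=1}^{i+1}\binom{m-1}{h-l}\binom{n-m}{l-1}\right)\leq\binom{n-1}{h-1},$$ with equality if and only if $i=h-1$.
   Context: Binomial coefficients $\binom{a}{b}$ with $b<0$ are taken to be $0$. -}

module Defs where

open import Data.Nat using (ℕ; zero; suc; _+_; _*_; _∸_; _^_; _<_)
open import Data.Nat.Combinatorics using (_C_)
open import Data.Integer using (ℤ; +_; -[1+_]; _-_)
open import Data.List using (List; map; upTo)
open import Data.Nat.ListAction using (sum)

binomℤ : ℕ → ℤ → ℕ
binomℤ a (+ b)      = a C b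
binomℤ a -[1+ _ ]   = 0

term : (n m h l : ℕ) → ℕ
term n m h l = binomℤ (m ∸ 1) (+ h - + l) * ((n ∸ m) C (l ∸ 1))

-- S n m h i = Σ_{l=1}^{i+1} C(m-1, h-l) C(n-m, l-1)
S : (n m h i : ℕ) → ℕ
S n m h i = sum (map (λ l → term n m h (suc l)) (upTo (suc i)))

-- Exact integer reformulation of  n > (m-1)/(1 - 2^{1/(1-h)}) + h - 1  (for n ≥ m ≥ h ≥ 2):
--   (n-h+1)^(h-1) < 2 (n-m-h+2)^(h-1)  with n-m-h+2 > 0 (truncated subtraction makes
--   the positivity automatic, since h-1 ≥ 1).
Bound : (n m h : ℕ) → Set
Bound n m h = (n + 1 ∸ h) ^ (h ∸ 1) < 2 * (n + 2 ∸ (m + h)) ^ (h ∸ 1)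

-- Write a = m - 1, b = n - m, k = h - 1. The sum is the partial sum s_{i+1} = Σ_{j<i+1} t_j of
-- the Vandermonde terms t_j = C(a, k-j) C(b, j), and s_{k+1} = C(n-1, h-1). With B = n - m - h + 2
-- the bound on n reads (a + B)^k < 2 B^k. By Bernoulli's inequality this forces k a < B, which
-- makes the terms grow fast: (k-j+2) t_j ≤ (k-j) t_{j+1} for j + 2 ≤ k. Comparing falling
-- factorials it also gives C(a+b, k) < 2 C(b, k), i.e. the last term t_k outweighs all the others.
-- Together, s_p < (k+1-p) t_p for every p ≤ k, which says exactly that (k+2-p) s_p strictly
-- increases in p up to p = k + 1, where it equals C(n-1, h-1); at p = i + 1 it is (h - i) S.

module Submission where

open import Defs
open import Data.Nat
  using (ℕ; zero; suc; _+_; _*_; _∸_; _^_; _≤_; _<_; _≤?_; z≤n; s≤s; z<s; s≤s⁻¹; NonZero; >-nonZero)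
open import Data.Nat.Properties
open import Data.Nat.Combinatorics using (_C_; nCk+nC[k+1]≡[n+1]C[k+1]; k>n⇒nCk≡0; nC1≡n)
open import Data.Nat.ListAction using (sum)
open import Data.Nat.ListAction.Properties using (sum-++)
open import Data.Nat.Tactic.RingSolver using (solve-∀)
open import Data.List using (applyUpTo; _++_; [_])
open import Data.List.Properties using (applyUpTo-∷ʳ; map-upTo)
open import Data.Integer.Properties using ([+m]-[+n]≡m⊖n; ⊖-≥)
open import Data.Product using (_×_; _,_)
open import Data.Sum using (inj₁; inj₂)
open import Function using (_∘_)
open import Function.Bundles using (_⇔_; mk⇔)
open import Relation.Binary.PropositionalEquality
  using (_≡_; refl; sym; trans; cong; cong₂; subst; module ≡-Reasoning)
open import Relation.Nullary using (Dec; yes; no; contradiction)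
import Algebra.Properties.CommutativeSemigroup +-commutativeSemigroup as +-CS
import Algebra.Properties.CommutativeSemigroup *-commutativeSemigroup as *-CS

sum-applyUpTo-suc : ∀ (f : ℕ → ℕ) n → sum (applyUpTo f (suc n)) ≡ sum (applyUpTo f n) + f n
sum-applyUpTo-suc f n = begin
  sum (applyUpTo f (suc n))        ≡⟨ cong sum (applyUpTo-∷ʳ f n) ⟨
  sum (applyUpTo f n ++ [ f n ])   ≡⟨ sum-++ (applyUpTo f n) [ f n ] ⟩
  sum (applyUpTo f n) + (f n + 0)  ≡⟨ cong (sum (applyUpTo f n) +_) (+-identityʳ (f n)) ⟩
  sum (applyUpTo f n) + f n        ∎
  where open ≡-Reasoning

sum-applyUpTo-cong : ∀ (f g : ℕ → ℕ) n → (∀ {j} → j < n → f j ≡ g j) →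
                     sum (applyUpTo f n) ≡ sum (applyUpTo g n)
sum-applyUpTo-cong f g zero    _   = refl
sum-applyUpTo-cong f g (suc n) f≗g =
  cong₂ _+_ (f≗g z<s) (sum-applyUpTo-cong (f ∘ suc) (g ∘ suc) n (f≗g ∘ s≤s))

sum-applyUpTo-+ : ∀ (f g : ℕ → ℕ) n →
  sum (applyUpTo (λ j → f j + g j) n) ≡ sum (applyUpTo f n) + sum (applyUpTo g n)
sum-applyUpTo-+ f g zero    = refl
sum-applyUpTo-+ f g (suc n) =
  trans (cong (f 0 + g 0 +_) (sum-applyUpTo-+ (f ∘ suc) (g ∘ suc) n)) (+-CS.interchange (f 0) (g 0) _ _)

sum-applyUpTo-zero : ∀ {f : ℕ → ℕ} n → (∀ j → f j ≡ 0) → sum (applyUpTo f n) ≡ 0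
sum-applyUpTo-zero zero    _   = refl
sum-applyUpTo-zero (suc n) f≗0 = cong₂ _+_ (f≗0 0) (sum-applyUpTo-zero n (f≗0 ∘ suc))

stepwise-<⇒< : ∀ (g : ℕ → ℕ) {K} → (∀ {p} → p < K → g p < g (suc p)) →
               ∀ {p} → p < K → g p < g K
stepwise-<⇒< g {suc K} step (s≤s p≤K) with m≤n⇒m<n∨m≡n p≤K
... | inj₁ p<K  = <-trans (stepwise-<⇒< g (step ∘ m<n⇒m<1+n) p<K) (step ≤-refl)
... | inj₂ refl = step ≤-refl

weighted-partial-sum-< : ∀ (t : ℕ → ℕ) {K} →
  (∀ {p} → p < K → sum (applyUpTo t p) < (K ∸ p) * t p) →
  ∀ {p} → p < K → (suc K ∸ p) * sum (applyUpTo t p) < sum (applyUpTo t K)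
weighted-partial-sum-< t {K} partial< {p} p<K = begin-strict
  weighted p        <⟨ stepwise-<⇒< weighted step p<K ⟩
  weighted K        ≡⟨ cong (_* Σ K) (m+n∸n≡m 1 K) ⟩
  1 * Σ K           ≡⟨ *-identityˡ (Σ K) ⟩
  Σ K               ∎
  where
  open ≤-Reasoning
  Σ : ℕ → ℕ
  Σ p = sum (applyUpTo t p)
  weighted : ℕ → ℕ
  weighted p = (suc K ∸ p) * Σ p
  step : ∀ {p} → p < K → weighted p < weighted (suc p)
  step {p} p<K = begin-strict
    (suc K ∸ p) * Σ p              ≡⟨ cong (_* Σ p) (+-∸-assoc 1 (<⇒≤ p<K)) ⟩
    Σ p + (K ∸ p) * Σ p            <⟨ +-monoˡ-< ((K ∸ p) * Σ p) (partial< p<K) ⟩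
    (K ∸ p) * t p + (K ∸ p) * Σ p  ≡⟨ +-comm ((K ∸ p) * t p) _ ⟩
    (K ∸ p) * Σ p + (K ∸ p) * t p  ≡⟨ *-distribˡ-+ (K ∸ p) (Σ p) (t p) ⟨
    (K ∸ p) * (Σ p + t p)          ≡⟨ cong ((K ∸ p) *_) (sum-applyUpTo-suc t p) ⟨
    (K ∸ p) * Σ (suc p)            ∎

k≤n⇒0<nCk : ∀ {n k} → k ≤ n → 0 < n C k
k≤n⇒0<nCk {k = zero}  _         = z<s
k≤n⇒0<nCk {k = suc k} (s≤s k≤n) =
  <-≤-trans (k≤n⇒0<nCk k≤n) (≤-trans (m≤m+n _ _) (≤-reflexive (nCk+nC[k+1]≡[n+1]C[k+1] _ k)))

[k+1]*nC[k+1]≡[n∸k]*nCk : ∀ n k → suc k * (n C suc k) ≡ (n ∸ k) * (n C k)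
[k+1]*nC[k+1]≡[n∸k]*nCk zero    k       = trans (*-zeroʳ (suc k)) (sym (cong (_* (0 C k)) (0∸n≡0 k)))
[k+1]*nC[k+1]≡[n∸k]*nCk (suc n) zero    = trans (*-identityˡ _) (trans (nC1≡n (suc n)) (sym (*-identityʳ _)))
[k+1]*nC[k+1]≡[n∸k]*nCk (suc n) (suc k) with suc k ≤? n
... | no  k≮n = begin
  suc (suc k) * (suc n C suc (suc k))  ≡⟨ cong (suc (suc k) *_) (k>n⇒nCk≡0 (s≤s (s≤s (≮⇒≥ k≮n)))) ⟩
  suc (suc k) * 0                      ≡⟨ *-zeroʳ (suc (suc k)) ⟩
  0                                    ≡⟨ cong (_* (suc n C suc k)) (m≤n⇒m∸n≡0 (≮⇒≥ k≮n)) ⟨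
  (n ∸ k) * (suc n C suc k)            ∎
  where open ≡-Reasoning
... | yes k<n = begin
  suc (suc k) * (suc n C suc (suc k))        ≡⟨ cong (suc (suc k) *_) (nCk+nC[k+1]≡[n+1]C[k+1] n (suc k)) ⟨
  suc (suc k) * (c + n C suc (suc k))        ≡⟨ *-distribˡ-+ (suc (suc k)) c _ ⟩
  suc (suc k) * c + suc (suc k) * (n C suc (suc k))
    ≡⟨ cong (suc (suc k) * c +_) ([k+1]*nC[k+1]≡[n∸k]*nCk n (suc k)) ⟩
  suc (suc k) * c + (n ∸ suc k) * c          ≡⟨ regroup k (n ∸ suc k) c ⟩
  suc k * c + suc (n ∸ suc k) * c
    ≡⟨ cong₂ _+_ ([k+1]*nC[k+1]≡[n∸k]*nCk n k) (cong (_* c) (sym (+-∸-assoc 1 k<n))) ⟩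
  (n ∸ k) * (n C k) + (n ∸ k) * c            ≡⟨ *-distribˡ-+ (n ∸ k) (n C k) c ⟨
  (n ∸ k) * (n C k + c)                      ≡⟨ cong ((n ∸ k) *_) (nCk+nC[k+1]≡[n+1]C[k+1] n k) ⟩
  (n ∸ k) * (suc n C suc k)                  ∎
  where
  open ≡-Reasoning
  c : ℕ
  c = n C suc k
  regroup : ∀ k d c → suc (suc k) * c + d * c ≡ suc k * c + suc d * c
  regroup = solve-∀

[y∸t]*p≤[x∸t]*q⇒yCr*p^r≤xCr*q^r : ∀ x y p q r → (∀ {t} → t < r → (y ∸ t) * p ≤ (x ∸ t) * q) →
                                  (y C r) * p ^ r ≤ (x C r) * q ^ r
[y∸t]*p≤[x∸t]*q⇒yCr*p^r≤xCr*q^r x y p q zero    _       = ≤-refl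
[y∸t]*p≤[x∸t]*q⇒yCr*p^r≤xCr*q^r x y p q (suc r) factor≤ = *-cancelˡ-≤ (suc r) (begin
  suc r * ((y C suc r) * p ^ suc r)      ≡⟨ peel y p ⟩
  ((y ∸ r) * p) * ((y C r) * p ^ r)      ≤⟨ *-mono-≤ (factor≤ ≤-refl) IH ⟩
  ((x ∸ r) * q) * ((x C r) * q ^ r)      ≡⟨ peel x q ⟨
  suc r * ((x C suc r) * q ^ suc r)      ∎)
  where
  open ≤-Reasoning
  IH : (y C r) * p ^ r ≤ (x C r) * q ^ r
  IH = [y∸t]*p≤[x∸t]*q⇒yCr*p^r≤xCr*q^r x y p q r (factor≤ ∘ m<n⇒m<1+n)
  peel : ∀ z w → suc r * ((z C suc r) * w ^ suc r) ≡ ((z ∸ r) * w) * ((z C r) * w ^ r)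
  peel z w = begin-equality
    suc r * ((z C suc r) * (w * w ^ r))   ≡⟨ *-assoc (suc r) (z C suc r) (w * w ^ r) ⟨
    (suc r * (z C suc r)) * (w * w ^ r)   ≡⟨ cong (_* (w * w ^ r)) ([k+1]*nC[k+1]≡[n∸k]*nCk z r) ⟩
    ((z ∸ r) * (z C r)) * (w * w ^ r)     ≡⟨ *-CS.interchange (z ∸ r) (z C r) w (w ^ r) ⟩
    ((z ∸ r) * w) * ((z C r) * w ^ r)     ∎

bernoulli : ∀ x a j → x ^ j * (x + j * a) ≤ (x + a) ^ j * x
bernoulli x a zero    = ≤-reflexive (+-identityʳ (x + 0))
bernoulli x a (suc j) = begin
  x * x ^ j * (x + suc j * a)          ≡⟨ *-CS.xy∙z≈y∙xz x (x ^ j) _ ⟩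
  x ^ j * (x * (x + suc j * a))
    ≤⟨ *-monoʳ-≤ (x ^ j) (≤-trans (m≤m+n _ (j * (a * a))) (≤-reflexive (expand x a j))) ⟩
  x ^ j * ((x + a) * (x + j * a))      ≡⟨ *-CS.x∙yz≈y∙xz (x ^ j) (x + a) _ ⟩
  (x + a) * (x ^ j * (x + j * a))      ≤⟨ *-monoʳ-≤ (x + a) (bernoulli x a j) ⟩
  (x + a) * ((x + a) ^ j * x)          ≡⟨ *-assoc (x + a) _ x ⟨
  (x + a) * (x + a) ^ j * x            ∎
  where
  open ≤-Reasoning
  expand : ∀ x a j → x * (x + suc j * a) + j * (a * a) ≡ (x + a) * (x + j * a)
  expand = solve-∀

vandermondeTerm : ℕ → ℕ → ℕ → ℕ → ℕ
vandermondeTerm a b k j = (a C (k ∸ j)) * (b C j)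

vandermonde : ∀ a b k → sum (applyUpTo (vandermondeTerm a b k) (suc k)) ≡ (a + b) C k
vandermonde a zero    k       = begin
  (a C k) * 1 + sum (applyUpTo (λ j → (a C (k ∸ suc j)) * 0) k)
    ≡⟨ cong₂ _+_ (*-identityʳ (a C k)) (sum-applyUpTo-zero k (λ j → *-zeroʳ (a C (k ∸ suc j)))) ⟩
  a C k + 0   ≡⟨ +-identityʳ (a C k) ⟩
  a C k       ≡⟨ cong (_C k) (+-identityʳ a) ⟨
  (a + 0) C k ∎
  where open ≡-Reasoning
vandermonde a (suc b) zero    = refl
vandermonde a (suc b) (suc k) = begin
  (a C suc k) * 1 + Σ raised
    ≡⟨ cong ((a C suc k) * 1 +_) (trans (sum-applyUpTo-cong raised split (suc k) (λ {j} _ → pascal-split j))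
                                        (sum-applyUpTo-+ (vandermondeTerm a b k) shifted (suc k))) ⟩
  (a C suc k) * 1 + (V k + Σ shifted)   ≡⟨ +-CS.x∙yz≈y∙xz ((a C suc k) * 1) (V k) (Σ shifted) ⟩
  V k + V (suc k)                       ≡⟨ cong₂ _+_ (vandermonde a b k) (vandermonde a b (suc k)) ⟩
  (a + b) C k + (a + b) C suc k         ≡⟨ nCk+nC[k+1]≡[n+1]C[k+1] (a + b) k ⟩
  suc (a + b) C suc k                   ≡⟨ cong (_C suc k) (+-suc a b) ⟨
  (a + suc b) C suc k                   ∎
  where
  open ≡-Reasoning
  Σ : (ℕ → ℕ) → ℕ
  Σ f = sum (applyUpTo f (suc k))
  V : ℕ → ℕ
  V l = sum (applyUpTo (vandermondeTerm a b l) (suc l))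
  shifted : ℕ → ℕ
  shifted j = (a C (k ∸ j)) * (b C suc j)
  raised split : ℕ → ℕ
  raised j = (a C (k ∸ j)) * (suc b C suc j)
  split j = vandermondeTerm a b k j + shifted j
  pascal-split : ∀ j → raised j ≡ split j
  pascal-split j = trans (cong ((a C (k ∸ j)) *_) (sym (nCk+nC[k+1]≡[n+1]C[k+1] b j)))
                         (*-distribˡ-+ (a C (k ∸ j)) (b C j) (b C suc j))

S≡∑vandermondeTerm : ∀ a b k {i} → i ≤ k →
  S (suc a + b) (suc a) (suc k) i ≡ sum (applyUpTo (vandermondeTerm a b k) (suc i))
S≡∑vandermondeTerm a b k {i} i≤k = begin
  S (suc a + b) (suc a) (suc k) i                 ≡⟨ cong sum (map-upTo summand (suc i)) ⟩
  sum (applyUpTo summand (suc i))                 ≡⟨ sum-applyUpTo-cong _ _ (suc i) (term≡ ∘ s≤s⁻¹) ⟩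
  sum (applyUpTo (vandermondeTerm a b k) (suc i)) ∎
  where
  open ≡-Reasoning
  summand : ℕ → ℕ
  summand l = term (suc a + b) (suc a) (suc k) (suc l)
  term≡ : ∀ {j} → j ≤ i → summand j ≡ vandermondeTerm a b k j
  term≡ {j} j≤i = cong₂ _*_
    (cong (binomℤ a) (trans ([+m]-[+n]≡m⊖n (suc k) (suc j)) (⊖-≥ (s≤s (≤-trans j≤i i≤k)))))
    (cong (_C j) (m+n∸m≡n a b))

Bound⇒[a+B]^k<2*B^k : ∀ a b k .{{_ : NonZero k}} → Bound (suc a + b) (suc a) (suc k) →
                      (a + (suc b ∸ k)) ^ k < 2 * (suc b ∸ k) ^ k
Bound⇒[a+B]^k<2*B^k a b k@(suc _) bound = by-cases (k ≤? suc b)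
  where
  Bounded : ℕ → ℕ → Set
  Bounded x y = x ^ k < 2 * y ^ k
  rhs≡ : (a + b) + 2 ∸ (a + suc k) ≡ suc b ∸ k
  rhs≡ = trans (cong (_∸ (a + suc k)) (trans (+-assoc a b 2) (cong (a +_) (+-comm b 2))))
               ([m+n]∸[m+o]≡n∸o a (suc (suc b)) (suc k))
  bound′ : Bounded ((a + b) + 1 ∸ k) (suc b ∸ k)
  bound′ = subst (Bounded ((a + b) + 1 ∸ k)) rhs≡ bound
  by-cases : Dec (k ≤ suc b) → Bounded (a + (suc b ∸ k)) (suc b ∸ k)
  by-cases (yes k≤1+b) = subst (λ x → Bounded x (suc b ∸ k)) lhs≡ bound′
    where
    lhs≡ : (a + b) + 1 ∸ k ≡ a + (suc b ∸ k)
    lhs≡ = trans (cong (_∸ k) (trans (+-comm (a + b) 1) (sym (+-suc a b)))) (+-∸-assoc a k≤1+b)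
  by-cases (no k≰1+b) = contradiction (subst (Bounded ((a + b) + 1 ∸ k)) B≡0 bound′) n≮0
    where
    B≡0 : suc b ∸ k ≡ 0
    B≡0 = m≤n⇒m∸n≡0 (<⇒≤ (≰⇒> k≰1+b))

B≤k*a⇒2*B^k≤[a+B]^k : ∀ a B k .{{_ : NonZero k}} → B ≤ k * a → 2 * B ^ k ≤ (a + B) ^ k
B≤k*a⇒2*B^k≤[a+B]^k a zero        (suc _) _    = z≤n
B≤k*a⇒2*B^k≤[a+B]^k a B@(suc _)   k       B≤ka = *-cancelʳ-≤ (2 * B ^ k) ((a + B) ^ k) B (begin
  2 * B ^ k * B        ≡⟨ double B (B ^ k) ⟩
  B ^ k * (B + B)      ≤⟨ *-monoʳ-≤ (B ^ k) (+-monoʳ-≤ B B≤ka) ⟩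
  B ^ k * (B + k * a)  ≤⟨ bernoulli B a k ⟩
  (B + a) ^ k * B      ≡⟨ cong (λ x → x ^ k * B) (+-comm B a) ⟩
  (a + B) ^ k * B      ∎)
  where
  open ≤-Reasoning
  double : ∀ B X → 2 * X * B ≡ X * (B + B)
  double = solve-∀

[a+B]^k<2*B^k⇒k*a<B : ∀ a B k .{{_ : NonZero k}} → (a + B) ^ k < 2 * B ^ k → k * a < B
[a+B]^k<2*B^k⇒k*a<B a B k bound = ≰⇒> (<⇒≱ bound ∘ B≤k*a⇒2*B^k≤[a+B]^k a B k)

[a+z]*B≤z*[a+B] : ∀ a {z B} → B ≤ z → (a + z) * B ≤ z * (a + B)
[a+z]*B≤z*[a+B] a {z} {B} B≤z = begin
  (a + z) * B      ≡⟨ *-distribʳ-+ B a z ⟩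
  a * B + z * B    ≤⟨ +-monoˡ-≤ (z * B) (*-monoʳ-≤ a B≤z) ⟩
  a * z + z * B    ≡⟨ cong (_+ z * B) (*-comm a z) ⟩
  z * a + z * B    ≡⟨ *-distribˡ-+ z a B ⟨
  z * (a + B)      ∎
  where open ≤-Reasoning

[a+B]^k<2*B^k⇒[a+b]Ck<2*bCk : ∀ a b k → k ≤ b →
  (a + (suc b ∸ k)) ^ k < 2 * (suc b ∸ k) ^ k → (a + b) C k < 2 * (b C k)
[a+B]^k<2*B^k⇒[a+b]Ck<2*bCk a b k k≤b bound =
  *-cancelʳ-< ((a + B) ^ k) ((a + b) C k) (2 * (b C k)) (begin-strict
  ((a + b) C k) * (a + B) ^ k     <⟨ *-monoʳ-< ((a + b) C k) {{>-nonZero [a+b]Ck>0}} bound ⟩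
  ((a + b) C k) * (2 * B ^ k)     ≡⟨ *-CS.x∙yz≈y∙xz ((a + b) C k) 2 (B ^ k) ⟩
  2 * (((a + b) C k) * B ^ k)
    ≤⟨ *-monoʳ-≤ 2 ([y∸t]*p≤[x∸t]*q⇒yCr*p^r≤xCr*q^r b (a + b) B (a + B) k factor≤) ⟩
  2 * ((b C k) * (a + B) ^ k)     ≡⟨ *-assoc 2 (b C k) ((a + B) ^ k) ⟨
  2 * (b C k) * (a + B) ^ k       ∎)
  where
  open ≤-Reasoning
  B : ℕ
  B = suc b ∸ k
  [a+b]Ck>0 : 0 < (a + b) C k
  [a+b]Ck>0 = k≤n⇒0<nCk (≤-trans k≤b (m≤n+m b a))
  factor≤ : ∀ {t} → t < k → (a + b ∸ t) * B ≤ (b ∸ t) * (a + B)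
  factor≤ {t} t<k = begin
    (a + b ∸ t) * B     ≡⟨ cong (_* B) (+-∸-assoc a (≤-trans (<⇒≤ t<k) k≤b)) ⟩
    (a + (b ∸ t)) * B   ≤⟨ [a+z]*B≤z*[a+B] a (∸-monoʳ-≤ (suc b) t<k) ⟩
    (b ∸ t) * (a + B)   ∎

Bound⇒k*a<B : ∀ a b k .{{_ : NonZero k}} → Bound (suc a + b) (suc a) (suc k) → k * a < suc b ∸ k
Bound⇒k*a<B a b k = [a+B]^k<2*B^k⇒k*a<B a (suc b ∸ k) k ∘ Bound⇒[a+B]^k<2*B^k a b k

Bound⇒[a+b]Ck<2*bCk : ∀ a b k .{{_ : NonZero k}} → Bound (suc a + b) (suc a) (suc k) →
                      (a + b) C k < 2 * (b C k)
Bound⇒[a+b]Ck<2*bCk a b k bound = [a+B]^k<2*B^k⇒[a+b]Ck<2*bCk a b k k≤b (Bound⇒[a+B]^k<2*B^k a b k bound)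
  where
  k≤b : k ≤ b
  k≤b = s≤s⁻¹ (m∸n≢0⇒n<m (>⇒≢ (≤-<-trans z≤n (Bound⇒k*a<B a b k bound))))

vandermondeTerm-ratio : ∀ a b {k j} → suc j ≤ k →
  vandermondeTerm a b k (suc j) * (suc j * (a ∸ (k ∸ suc j)))
    ≡ vandermondeTerm a b k j * ((k ∸ j) * (b ∸ j))
vandermondeTerm-ratio a b {k} {j} 1+j≤k = begin
  (a C r) * (b C suc j) * (suc j * (a ∸ r))          ≡⟨ regroup (a C r) (b C suc j) (suc j) (a ∸ r) ⟩
  ((a ∸ r) * (a C r)) * (suc j * (b C suc j))
    ≡⟨ cong₂ _*_ ([k+1]*nC[k+1]≡[n∸k]*nCk a r) (sym ([k+1]*nC[k+1]≡[n∸k]*nCk b j)) ⟨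
  (suc r * (a C suc r)) * ((b ∸ j) * (b C j))        ≡⟨ regroup′ (suc r) (a C suc r) (b ∸ j) (b C j) ⟩
  (a C suc r) * (b C j) * (suc r * (b ∸ j))
    ≡⟨ cong (λ d → (a C d) * (b C j) * (d * (b ∸ j))) k∸j≡1+r ⟨
  (a C (k ∸ j)) * (b C j) * ((k ∸ j) * (b ∸ j))      ∎
  where
  open ≡-Reasoning
  r : ℕ
  r = k ∸ suc j
  k∸j≡1+r : k ∸ j ≡ suc r
  k∸j≡1+r = +-∸-assoc 1 1+j≤k
  regroup : ∀ x y s z → x * y * (s * z) ≡ (z * x) * (s * y)
  regroup = solve-∀
  regroup′ : ∀ s x z y → (s * x) * (z * y) ≡ x * y * (s * z)
  regroup′ = solve-∀

2≤d⇒d+2≤d*d : ∀ {d} → 2 ≤ d → d + 2 ≤ d * d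
2≤d⇒d+2≤d*d {d} 2≤d = begin
  d + 2        ≤⟨ +-monoʳ-≤ d 2≤d ⟩
  d + d        ≡⟨ cong (d +_) (+-identityʳ d) ⟨
  2 * d        ≤⟨ *-monoˡ-≤ d 2≤d ⟩
  d * d        ∎
  where open ≤-Reasoning

module _ {a b k : ℕ} (k≤a : k ≤ a) (k*a<B : k * a < suc b ∸ k) (half : (a + b) C k < 2 * (b C k)) where

  private
    T : ℕ → ℕ
    T = vandermondeTerm a b k
    Σ : ℕ → ℕ
    Σ p = sum (applyUpTo T p)

  vandermondeTerm-growth : ∀ {j} → 2 + j ≤ k → (k ∸ j + 2) * T j ≤ (k ∸ j) * T (suc j)
  vandermondeTerm-growth {j} 2+j≤k = *-cancelʳ-≤ _ _ X {{X≢0}} (begin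
    (d + 2) * T j * X            ≡⟨ *-CS.xy∙z≈y∙xz (d + 2) (T j) X ⟩
    T j * ((d + 2) * X)          ≤⟨ *-monoʳ-≤ (T j) (*-mono-≤ (2≤d⇒d+2≤d*d 2≤d) X≤b∸j) ⟩
    T j * (d * d * (b ∸ j))      ≡⟨ cong (T j *_) (*-assoc d d (b ∸ j)) ⟩
    T j * (d * (d * (b ∸ j)))    ≡⟨ *-CS.x∙yz≈y∙xz (T j) d _ ⟩
    d * (T j * (d * (b ∸ j)))    ≡⟨ cong (d *_) (vandermondeTerm-ratio a b 1+j≤k) ⟨
    d * (T (suc j) * X)          ≡⟨ *-assoc d (T (suc j)) X ⟨
    d * T (suc j) * X            ∎)
    where
    open ≤-Reasoning
    d r X : ℕ
    d = k ∸ j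
    r = k ∸ suc j
    X = suc j * (a ∸ r)
    1+j≤k : suc j ≤ k
    1+j≤k = <⇒≤ 2+j≤k
    2≤d : 2 ≤ d
    2≤d = m+n≤o⇒m≤o∸n 2 2+j≤k
    X≢0 : NonZero X
    X≢0 = m*n≢0 (suc j) (a ∸ r) {{_}} {{>-nonZero (m<n⇒0<n∸m (<-≤-trans (∸-monoʳ-< z<s 1+j≤k) k≤a))}}
    X≤b∸j : X ≤ b ∸ j
    X≤b∸j = ≤-trans (*-mono-≤ 1+j≤k (m∸n≤m a r)) (<⇒≤ (<-≤-trans k*a<B (∸-monoʳ-≤ (suc b) 1+j≤k)))

  last-partial-sum< : Σ k < (suc k ∸ k) * T k
  last-partial-sum< = begin-strict
    Σ k                 <⟨ +-cancelʳ-< (T k) (Σ k) (T k) (begin-strict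
        Σ k + T k           ≡⟨ sum-applyUpTo-suc T k ⟨
        Σ (suc k)           ≡⟨ vandermonde a b k ⟩
        (a + b) C k         <⟨ half ⟩
        2 * (b C k)         ≡⟨ cong (λ x → x + (x + 0)) Tk≡bCk ⟨
        T k + (T k + 0)     ≡⟨ cong (T k +_) (+-identityʳ (T k)) ⟩
        T k + T k           ∎) ⟩
    T k                 ≡⟨ *-identityˡ (T k) ⟨
    1 * T k             ≡⟨ cong (_* T k) (m+n∸n≡m 1 k) ⟨
    (suc k ∸ k) * T k   ∎
    where
    open ≤-Reasoning
    Tk≡bCk : T k ≡ b C k
    Tk≡bCk = trans (cong (λ x → (a C x) * (b C k)) (n∸n≡0 k)) (*-identityˡ (b C k))

  partial-sum< : ∀ {p} → p ≤ k → Σ p < (suc k ∸ p) * T p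
  partial-sum< {zero}  _     = begin-strict
    0                  <⟨ k≤n⇒0<nCk k≤a ⟩
    a C k              ≡⟨ *-identityʳ (a C k) ⟨
    T 0                ≤⟨ m≤n*m (T 0) (suc k) ⟩
    suc k * T 0        ∎
    where open ≤-Reasoning
  partial-sum< {suc p} 1+p≤k with m≤n⇒m<n∨m≡n 1+p≤k
  ... | inj₂ 1+p≡k = subst (λ q → Σ q < (suc k ∸ q) * T q) (sym 1+p≡k) last-partial-sum<
  ... | inj₁ 2+p≤k = begin-strict
    Σ (suc p)                  ≡⟨ sum-applyUpTo-suc T p ⟩
    Σ p + T p                  <⟨ +-monoˡ-< (T p) (partial-sum< (<⇒≤ 1+p≤k)) ⟩
    (suc k ∸ p) * T p + T p    ≡⟨ cong (λ x → x * T p + T p) (+-∸-assoc 1 (<⇒≤ 1+p≤k)) ⟩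
    suc (k ∸ p) * T p + T p    ≡⟨ regroup (k ∸ p) (T p) ⟩
    (k ∸ p + 2) * T p          ≤⟨ vandermondeTerm-growth 2+p≤k ⟩
    (k ∸ p) * T (suc p)        ∎
    where
    open ≤-Reasoning
    regroup : ∀ d x → suc d * x + x ≡ (d + 2) * x
    regroup = solve-∀

  weighted-S< : ∀ {i} → i < k → (suc k ∸ i) * S (suc a + b) (suc a) (suc k) i < (a + b) C k
  weighted-S< {i} i<k = begin-strict
    (suc k ∸ i) * S (suc a + b) (suc a) (suc k) i
      ≡⟨ cong ((suc k ∸ i) *_) (S≡∑vandermondeTerm a b k (<⇒≤ i<k)) ⟩
    (suc k ∸ i) * Σ (suc i)
      <⟨ weighted-partial-sum-< T (partial-sum< ∘ s≤s⁻¹) (s≤s i<k) ⟩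
    Σ (suc k)                 ≡⟨ vandermonde a b k ⟩
    (a + b) C k               ∎
    where open ≤-Reasoning

weighted-S≡ : ∀ a b k → (suc k ∸ k) * S (suc a + b) (suc a) (suc k) k ≡ (a + b) C k
weighted-S≡ a b k = begin
  (suc k ∸ k) * S (suc a + b) (suc a) (suc k) k
    ≡⟨ cong₂ _*_ (m+n∸n≡m 1 k) (S≡∑vandermondeTerm a b k ≤-refl) ⟩
  1 * sum (applyUpTo (vandermondeTerm a b k) (suc k))   ≡⟨ *-identityˡ _ ⟩
  sum (applyUpTo (vandermondeTerm a b k) (suc k))       ≡⟨ vandermonde a b k ⟩
  (a + b) C k                                           ∎
  where open ≡-Reasoning

lemma2p2 : (n m h : ℕ) → m ≤ n → h ≤ m → 2 ≤ h → Bound n m h →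
    (i : ℕ) → 1 ≤ i → i ≤ h →
      ((h ∸ i) * S n m h i ≤ (n ∸ 1) C (h ∸ 1))
      × (((h ∸ i) * S n m h i ≡ (n ∸ 1) C (h ∸ 1)) ⇔ (i ≡ h ∸ 1))
lemma2p2 n (suc a) (suc k@(suc _)) m≤n (s≤s k≤a) (s≤s (s≤s z≤n)) bound i _ i≤1+k
  with m≤n⇒∃[o]m+o≡n m≤n
... | b , refl with m≤n⇒m<n∨m≡n i≤1+k
... | inj₂ refl =
  ≤-trans (≤-reflexive zero-weight) z≤n ,
  mk⇔ (λ eq → contradiction (trans (sym zero-weight) eq) (<⇒≢ binomial>0))
      (λ 1+k≡k → contradiction 1+k≡k 1+n≢n)
  where
  zero-weight : (k ∸ k) * S (suc a + b) (suc a) (suc k) (suc k) ≡ 0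
  zero-weight = cong (_* S (suc a + b) (suc a) (suc k) (suc k)) (n∸n≡0 k)
  binomial>0 : 0 < (a + b) C k
  binomial>0 = k≤n⇒0<nCk (≤-trans k≤a (m≤m+n a b))
... | inj₁ (s≤s i≤k) with m≤n⇒m<n∨m≡n i≤k
...   | inj₂ refl = ≤-reflexive (weighted-S≡ a b k) , mk⇔ (λ _ → refl) (λ _ → weighted-S≡ a b k)
...   | inj₁ i<k  = <⇒≤ S< , mk⇔ (λ eq → contradiction eq (<⇒≢ S<)) (λ i≡k → contradiction i≡k (<⇒≢ i<k))
  where
  S< : (suc k ∸ i) * S (suc a + b) (suc a) (suc k) i < (a + b) C k
  S< = weighted-S< k≤a (Bound⇒k*a<B a b k bound) (Bound⇒[a+b]Ck<2*bCk a b k bound) i<k
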